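{- $\mathcal{Z}_q=\left\langle \zeta_q^{\mathrm{SZ}}(k_1,\dots,k_r)\,\middle|\, r\ge 0,\ k_1\ge 1,\ k_2,\dots,k_r\ge 0\right\rangle_{\mathbb{Q}}$.
   Context: $q$ is a formal variable. For $r\ge 0$, integers $k_1,\dots,k_r\ge 0$ and polynomials $Q_1\in X\mathbb{Q}[X]$, $Q_2,\dots,Q_r\in\mathbb{Q}[X]$ with $\deg(Q_j)\le k_j$, set $\zeta_q(k_1,\dots,k_r;Q_1,\dots,Q_r):=\sum_{m_1>\dots>m_r>0}\prod_{j=1}^r\frac{Q_j(q^{m_j})}{(1-q^{m_j})^{k_j}}\in\mathbb{Q}[[q]]$, with the empty value equal to $1$; $\mathcal{Z}_q$ is the $\mathbb{Q}$-span of all these series. For $k_1\ge1$, $k_2,\dots,k_r\ge 0$ the Schlesinger--Zudilin value is $\zeta_q^{\mathrm{SZ}}(k_1,\dots,k_r):=\zeta_q(k_1,\dots,k_r;X^{k_1},\dots,X^{k_r})=\sum_{m_1>\dots>m_r>0}\prod_{j=1}^r\frac{q^{m_jk_j}}{(1-q^{m_j})^{k_j}}$, and $\zeta_q^{\mathrm{SZ}}(\emptyset)=1$. -}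

module Defs where

open import Data.Nat using (ℕ; zero; suc; _∸_; _≟_)
open import Data.Nat.DivMod using (_%_; _/_)
open import Data.Rational using (ℚ; 0ℚ; 1ℚ; _+_; _*_)
open import Data.List using (List; []; _∷_; map; foldr)
open import Data.Vec using (Vec; []; _∷_)
open import Data.Product using (Σ; Σ-syntax; ∃; _×_; _,_)
open import Data.Unit using (⊤)
open import Relation.Binary.PropositionalEquality using (_≡_)
open import Relation.Nullary.Decidable using (does)
open import Data.Bool using (if_then_else_)

-- Formal power series in q over ℚ, as coefficient sequences.
PS : Set
PS = ℕ → ℚ

zeroPS : PS
zeroPS _ = 0ℚ

onePS : PS
onePS zero    = 1ℚ
onePS (suc _) = 0ℚ

_⊕_ : PS → PS → PS
(f ⊕ g) n = f n + g n

_·_ : ℚ → PS → PS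
(c · f) n = c * f n

sumℚ : (ℕ → ℚ) → ℕ → ℚ
sumℚ g zero    = 0ℚ
sumℚ g (suc N) = sumℚ g N + g N

_⊗_ : PS → PS → PS
(f ⊗ g) n = sumℚ (λ i → f i * g (n ∸ i)) (suc n)

sumPS : (ℕ → PS) → ℕ → PS
sumPS g zero    = zeroPS
sumPS g (suc N) = sumPS g N ⊕ g N

mono : ℕ → PS
mono d n = if does (n ≟ d) then 1ℚ else 0ℚ

-- 1/(1 - q^(suc m)) = Σ_j q^((suc m) j)
geom : ℕ → PS
geom m n = if does (n % suc m ≟ 0) then 1ℚ else 0ℚ

geomPow : ℕ → ℕ → PS
geomPow m zero    = onePS
geomPow m (suc k) = geom m ⊗ geomPow m k

-- A polynomial of degree ≤ k as its coefficient vector (c₀, …, c_k);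
-- evalAt cs d j = Σ_i c_i q^(d (j + i)), so evalAt cs d 0 = Q(q^d).
evalAt : ∀ {n} → Vec ℚ n → ℕ → ℕ → PS
evalAt []       d j = zeroPS
evalAt (c ∷ cs) d j = (c · mono (d Data.Nat.* j)) ⊕ evalAt cs d (suc j)

-- An entry (k_j, Q_j) with deg Q_j ≤ k_j.
Entry : Set
Entry = Σ ℕ (λ k → Vec ℚ (suc k))

-- Q(q^m) / (1 - q^m)^k  with m = suc i
factor : Entry → ℕ → PS
factor (k , cs) i = evalAt cs (suc i) 0 ⊗ geomPow i k

-- Σ_{M > m_1 > ... > m_r > 0} Π_j factor
bounded : List Entry → ℕ → PS
bounded []       M = onePS
bounded (e ∷ es) M = sumPS (λ i → factor e i ⊗ bounded es (suc i)) (M ∸ 1)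

-- ζ_q(k_1,…,k_r; Q_1,…,Q_r).  Since Q_1(0) = 0, the term with index m_1
-- has q-order ≥ m_1, so the n-th coefficient only involves m_1 ≤ n
-- (we sum over m_1 ≤ n+1).
zetaq : List Entry → PS
zetaq []       = onePS
zetaq (e ∷ es) n = bounded (e ∷ es) (suc (suc n)) n

Admissible : List Entry → Set
Admissible []                    = ⊤
Admissible ((k , c ∷ cs) ∷ es)   = c ≡ 0ℚ

xPow : (k : ℕ) → Vec ℚ (suc k)
xPow zero    = 1ℚ ∷ []
xPow (suc k) = 0ℚ ∷ xPow k

szEntry : ℕ → Entry
szEntry k = k , xPow k

zetaSZ : List ℕ → PS
zetaSZ ks = zetaq (map szEntry ks)

SZAdmissible : List ℕ → Set
SZAdmissible []       = ⊤
SZAdmissible (k ∷ ks) = Σ ℕ (λ k' → k ≡ suc k')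

InSpan : {I : Set} → (I → PS) → PS → Set
InSpan {I} G f =
  Σ (List (ℚ × I)) (λ cs → ∀ n → f n ≡ foldr (λ { (c , i) acc → c * G i n + acc }) 0ℚ cs)

ZGen : Σ (List Entry) Admissible → PS
ZGen (es , _) = zetaq es

SZGen : Σ (List ℕ) SZAdmissible → PS
SZGen (ks , _) = zetaSZ ks

-- Put x = q^m and y = x/(1-x), so that 1/(1-x) = 1 + y.  Writing Q = c + X·Q' with
-- deg Q' < k gives Q(x)/(1-x)^k = c (1+y)^k + y · Q'(x)/(1-x)^(k-1), hence by induction
-- on k every factor Q(x)/(1-x)^k is a ℚ-combination of the Schlesinger–Zudilin factors
-- y^j = x^j/(1-x)^j with j ≤ k, and of those with j ≥ 1 when Q(0) = 0.  The nested sum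
-- defining ζ_q is multilinear in its factors, so expanding every factor writes each
-- generator of 𝒵_q as a combination of SZ values; conversely every SZ value is itself
-- a generator of 𝒵_q.
module Submission where

open import Defs
open import Data.Bool using (if_then_else_)
open import Data.List using (List; []; _∷_; _++_; map; foldr)
open import Data.Nat as ℕ using (ℕ; zero; suc; _∸_; _<_; s≤s; _≟_)
import Data.Nat.Properties as ℕₚ
open import Data.Nat.DivMod using (_%_; [m+n]%n≡m%n; m<n⇒m%n≡m)
open import Data.Product using (Σ; _×_; _,_; proj₁; proj₂; uncurry)
open import Data.Rational using (ℚ; 0ℚ; 1ℚ; _+_; _*_)
open import Data.Rational.Properties
  using (+-assoc; +-comm; +-identityˡ; +-identityʳ; *-assoc; *-comm; *-identityˡ;
         *-zeroˡ; *-zeroʳ; *-distribˡ-+; *-distribʳ-+)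
open import Data.Rational.Solver using (module +-*-Solver)
open import Data.Sum using (inj₁; inj₂)
open import Data.Unit using (tt)
open import Data.Vec using (Vec; []; _∷_)
open import Function using (_∘_)
open import Relation.Binary.Bundles using (Setoid)
open import Relation.Binary.PropositionalEquality
open import Relation.Nullary.Decidable using (does)
import Relation.Binary.Reasoning.Setoid as SetoidReasoning

open +-*-Solver using (solve; _:+_; _:*_; _:=_; con)

sumℚ-cong : ∀ {f g} N → (∀ i → i < N → f i ≡ g i) → sumℚ f N ≡ sumℚ g N
sumℚ-cong zero    f≡g = refl
sumℚ-cong (suc N) f≡g =
  cong₂ _+_ (sumℚ-cong N (λ i i<N → f≡g i (ℕₚ.m<n⇒m<1+n i<N))) (f≡g N ℕₚ.≤-refl)

sumℚ-+ : ∀ f g N → sumℚ (λ i → f i + g i) N ≡ sumℚ f N + sumℚ g N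
sumℚ-+ f g zero    = refl
sumℚ-+ f g (suc N) rewrite sumℚ-+ f g N =
  solve 4 (λ a b c d → (a :+ b) :+ (c :+ d) := (a :+ c) :+ (b :+ d)) refl
    (sumℚ f N) (sumℚ g N) (f N) (g N)

sumℚ-*ˡ : ∀ c f N → sumℚ (λ i → c * f i) N ≡ c * sumℚ f N
sumℚ-*ˡ c f zero    = sym (*-zeroʳ c)
sumℚ-*ˡ c f (suc N) rewrite sumℚ-*ˡ c f N = sym (*-distribˡ-+ c (sumℚ f N) (f N))

sumℚ-zero : ∀ N → sumℚ (λ _ → 0ℚ) N ≡ 0ℚ
sumℚ-zero zero    = refl
sumℚ-zero (suc N) rewrite sumℚ-zero N = refl

sumℚ-suc : ∀ f N → sumℚ f (suc N) ≡ f 0 + sumℚ (f ∘ suc) N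
sumℚ-suc f zero    = +-comm 0ℚ (f 0)
sumℚ-suc f (suc N) rewrite sumℚ-suc f N = +-assoc (f 0) _ _

sumℚ-reverse : ∀ h n → sumℚ h (suc n) ≡ sumℚ (λ i → h (n ∸ i)) (suc n)
sumℚ-reverse h zero    = refl
sumℚ-reverse h (suc n) = begin
  sumℚ h (suc n) + h (suc n)                    ≡⟨ cong (_+ h (suc n)) (sumℚ-reverse h n) ⟩
  sumℚ (λ i → h (n ∸ i)) (suc n) + h (suc n)    ≡⟨ +-comm _ (h (suc n)) ⟩
  h (suc n) + sumℚ (λ i → h (n ∸ i)) (suc n)    ≡⟨ sym (sumℚ-suc (λ i → h (suc n ∸ i)) (suc n)) ⟩
  sumℚ (λ i → h (suc n ∸ i)) (suc (suc n))      ∎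
  where open ≡-Reasoning

PS-setoid : Setoid _ _
PS-setoid = record
  { Carrier       = PS
  ; _≈_           = _≗_
  ; isEquivalence = record { refl = λ _ → refl ; sym = λ p n → sym (p n) ; trans = λ p q n → trans (p n) (q n) }
  }

open Setoid PS-setoid using () renaming (refl to ≗-refl; sym to ≗-sym; trans to ≗-trans)

module ≈-Reasoning = SetoidReasoning PS-setoid

⊕-cong : ∀ {f f′ g g′} → f ≗ f′ → g ≗ g′ → f ⊕ g ≗ f′ ⊕ g′
⊕-cong p q n = cong₂ _+_ (p n) (q n)

⊕-congˡ : ∀ {f f′} g → f ≗ f′ → f ⊕ g ≗ f′ ⊕ g
⊕-congˡ g p n = cong (_+ g n) (p n)

⊕-congʳ : ∀ f {g g′} → g ≗ g′ → f ⊕ g ≗ f ⊕ g′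
⊕-congʳ f q n = cong (f n +_) (q n)

⊕-assoc : ∀ f g h → (f ⊕ g) ⊕ h ≗ f ⊕ (g ⊕ h)
⊕-assoc f g h n = +-assoc (f n) (g n) (h n)

⊕-identityˡ : ∀ f → zeroPS ⊕ f ≗ f
⊕-identityˡ f n = +-identityˡ (f n)

⊕-identityʳ : ∀ f → f ⊕ zeroPS ≗ f
⊕-identityʳ f n = +-identityʳ (f n)

·-cong : ∀ c {f f′} → f ≗ f′ → c · f ≗ c · f′
·-cong c p n = cong (c *_) (p n)

·-distribˡ-⊕ : ∀ c f g → c · (f ⊕ g) ≗ (c · f) ⊕ (c · g)
·-distribˡ-⊕ c f g n = *-distribˡ-+ c (f n) (g n)

·-zeroˡ : ∀ f → 0ℚ · f ≗ zeroPS
·-zeroˡ f n = *-zeroˡ (f n)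

·-zeroʳ : ∀ c → c · zeroPS ≗ zeroPS
·-zeroʳ c n = *-zeroʳ c

·-identityˡ : ∀ f → 1ℚ · f ≗ f
·-identityˡ f n = *-identityˡ (f n)

·-assoc : ∀ a b f → a · (b · f) ≗ (a * b) · f
·-assoc a b f n = sym (*-assoc a b (f n))

⊗-suc : ∀ f g n → (f ⊗ g) (suc n) ≡ f 0 * g (suc n) + ((f ∘ suc) ⊗ g) n
⊗-suc f g n = sumℚ-suc (λ i → f i * g (suc n ∸ i)) (suc n)

⊗-congˡ : ∀ {f f′} g → f ≗ f′ → f ⊗ g ≗ f′ ⊗ g
⊗-congˡ g p n = sumℚ-cong (suc n) (λ i _ → cong (_* g (n ∸ i)) (p i))

⊗-congʳ : ∀ f {g g′} → g ≗ g′ → f ⊗ g ≗ f ⊗ g′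
⊗-congʳ f p n = sumℚ-cong (suc n) (λ i _ → cong (f i *_) (p (n ∸ i)))

⊗-comm : ∀ f g → f ⊗ g ≗ g ⊗ f
⊗-comm f g n = trans (sumℚ-reverse _ n) (sumℚ-cong (suc n) λ i i≤n →
  trans (cong (λ j → f (n ∸ i) * g j) (ℕₚ.m∸[m∸n]≡n (ℕₚ.≤-pred i≤n))) (*-comm (f (n ∸ i)) (g i)))

⊗-distribʳ-⊕ : ∀ f g h → (f ⊕ g) ⊗ h ≗ (f ⊗ h) ⊕ (g ⊗ h)
⊗-distribʳ-⊕ f g h n =
  trans (sumℚ-cong (suc n) (λ i _ → *-distribʳ-+ (h (n ∸ i)) (f i) (g i))) (sumℚ-+ _ _ (suc n))

⊗-distribˡ-⊕ : ∀ h f g → h ⊗ (f ⊕ g) ≗ (h ⊗ f) ⊕ (h ⊗ g)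
⊗-distribˡ-⊕ h f g =
  ≗-trans (⊗-comm h (f ⊕ g)) (≗-trans (⊗-distribʳ-⊕ f g h) (⊕-cong (⊗-comm f h) (⊗-comm g h)))

·-⊗ : ∀ c f h → (c · f) ⊗ h ≗ c · (f ⊗ h)
·-⊗ c f h n = trans (sumℚ-cong (suc n) (λ i _ → *-assoc c (f i) (h (n ∸ i)))) (sumℚ-*ˡ c _ (suc n))

⊗-· : ∀ c h f → h ⊗ (c · f) ≗ c · (h ⊗ f)
⊗-· c h f = ≗-trans (⊗-comm h (c · f)) (≗-trans (·-⊗ c f h) (·-cong c (⊗-comm f h)))

⊗-zeroˡ : ∀ h → zeroPS ⊗ h ≗ zeroPS
⊗-zeroˡ h n = trans (sumℚ-cong (suc n) (λ i _ → *-zeroˡ (h (n ∸ i)))) (sumℚ-zero (suc n))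

⊗-zeroʳ : ∀ h → h ⊗ zeroPS ≗ zeroPS
⊗-zeroʳ h = ≗-trans (⊗-comm h zeroPS) (⊗-zeroˡ h)

⊗-identityˡ : ∀ f → onePS ⊗ f ≗ f
⊗-identityˡ f zero    = trans (+-identityˡ _) (*-identityˡ _)
⊗-identityˡ f (suc n) = begin
  (onePS ⊗ f) (suc n)              ≡⟨ ⊗-suc onePS f n ⟩
  1ℚ * f (suc n) + (zeroPS ⊗ f) n  ≡⟨ cong₂ _+_ (*-identityˡ (f (suc n))) (⊗-zeroˡ f n) ⟩
  f (suc n) + 0ℚ                   ≡⟨ +-identityʳ (f (suc n)) ⟩
  f (suc n)                        ∎
  where open ≡-Reasoning

⊗-identityʳ : ∀ f → f ⊗ onePS ≗ f
⊗-identityʳ f = ≗-trans (⊗-comm f onePS) (⊗-identityˡ f)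

⊗-assoc : ∀ f g h → (f ⊗ g) ⊗ h ≗ f ⊗ (g ⊗ h)
⊗-assoc f g h zero = solve 3 (λ a b c → con 0ℚ :+ (con 0ℚ :+ a :* b) :* c := con 0ℚ :+ a :* (con 0ℚ :+ b :* c))
  refl (f 0) (g 0) (h 0)
⊗-assoc f g h (suc n) = begin
  ((f ⊗ g) ⊗ h) (suc n)
    ≡⟨ ⊗-suc (f ⊗ g) h n ⟩
  (0ℚ + f 0 * g 0) * h (suc n) + (((f ⊗ g) ∘ suc) ⊗ h) n
    ≡⟨ cong₂ _+_ (cong (_* h (suc n)) (+-identityˡ (f 0 * g 0))) (⊗-congˡ h (⊗-suc f g) n) ⟩
  f 0 * g 0 * h (suc n) + (((f 0 · (g ∘ suc)) ⊕ ((f ∘ suc) ⊗ g)) ⊗ h) n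
    ≡⟨ cong (f 0 * g 0 * h (suc n) +_) (⊗-distribʳ-⊕ (f 0 · (g ∘ suc)) ((f ∘ suc) ⊗ g) h n) ⟩
  f 0 * g 0 * h (suc n) + (((f 0 · (g ∘ suc)) ⊗ h) n + (((f ∘ suc) ⊗ g) ⊗ h) n)
    ≡⟨ cong₂ (λ a b → f 0 * g 0 * h (suc n) + (a + b)) (·-⊗ (f 0) (g ∘ suc) h n) (⊗-assoc (f ∘ suc) g h n) ⟩
  f 0 * g 0 * h (suc n) + (f 0 * ((g ∘ suc) ⊗ h) n + ((f ∘ suc) ⊗ (g ⊗ h)) n)
    ≡⟨ solve 5 (λ a b c d e → a :* b :* c :+ (a :* d :+ e) := a :* (b :* c :+ d) :+ e) refl
         (f 0) (g 0) (h (suc n)) (((g ∘ suc) ⊗ h) n) (((f ∘ suc) ⊗ (g ⊗ h)) n) ⟩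
  f 0 * (g 0 * h (suc n) + ((g ∘ suc) ⊗ h) n) + ((f ∘ suc) ⊗ (g ⊗ h)) n
    ≡⟨ cong (λ z → f 0 * z + ((f ∘ suc) ⊗ (g ⊗ h)) n) (sym (⊗-suc g h n)) ⟩
  f 0 * (g ⊗ h) (suc n) + ((f ∘ suc) ⊗ (g ⊗ h)) n
    ≡⟨ sym (⊗-suc f (g ⊗ h) n) ⟩
  (f ⊗ (g ⊗ h)) (suc n)
    ∎
  where open ≡-Reasoning

⊗-interchange : ∀ a b c d → (a ⊗ b) ⊗ (c ⊗ d) ≗ (a ⊗ c) ⊗ (b ⊗ d)
⊗-interchange a b c d = begin
  (a ⊗ b) ⊗ (c ⊗ d)  ≈⟨ ⊗-assoc a b (c ⊗ d) ⟩
  a ⊗ (b ⊗ (c ⊗ d))  ≈⟨ ⊗-congʳ a (≗-sym (⊗-assoc b c d)) ⟩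
  a ⊗ ((b ⊗ c) ⊗ d)  ≈⟨ ⊗-congʳ a (⊗-congˡ d (⊗-comm b c)) ⟩
  a ⊗ ((c ⊗ b) ⊗ d)  ≈⟨ ⊗-congʳ a (⊗-assoc c b d) ⟩
  a ⊗ (c ⊗ (b ⊗ d))  ≈⟨ ≗-sym (⊗-assoc a c (b ⊗ d)) ⟩
  (a ⊗ c) ⊗ (b ⊗ d)  ∎
  where open ≈-Reasoning

shift : ℕ → PS → PS
shift zero    f         = f
shift (suc a) f zero    = 0ℚ
shift (suc a) f (suc n) = shift a f n

shift-+ : ∀ a f r → shift a f (a ℕ.+ r) ≡ f r
shift-+ zero    f r = refl
shift-+ (suc a) f r = shift-+ a f r

shift-< : ∀ a f {n} → n < a → shift a f n ≡ 0ℚ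
shift-< (suc a) f {zero}  _         = refl
shift-< (suc a) f {suc n} (s≤s n<a) = shift-< a f n<a

mono-zero : mono 0 ≗ onePS
mono-zero zero    = refl
mono-zero (suc n) = refl

mono-⊗ : ∀ a f → mono a ⊗ f ≗ shift a f
mono-⊗ zero    f         = ≗-trans (⊗-congˡ f mono-zero) (⊗-identityˡ f)
mono-⊗ (suc a) f zero    = trans (+-identityˡ (0ℚ * f 0)) (*-zeroˡ (f 0))
mono-⊗ (suc a) f (suc n) = begin
  (mono (suc a) ⊗ f) (suc n)                       ≡⟨ ⊗-suc (mono (suc a)) f n ⟩
  0ℚ * f (suc n) + ((mono (suc a) ∘ suc) ⊗ f) n    ≡⟨ cong₂ _+_ (*-zeroˡ (f (suc n))) (⊗-congˡ {mono (suc a) ∘ suc} {mono a} f (λ _ → refl) n) ⟩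
  0ℚ + (mono a ⊗ f) n                              ≡⟨ +-identityˡ _ ⟩
  (mono a ⊗ f) n                                   ≡⟨ mono-⊗ a f n ⟩
  shift a f n                                      ∎
  where open ≡-Reasoning

mono-+ : ∀ a b → mono a ⊗ mono b ≗ mono (a ℕ.+ b)
mono-+ a b = ≗-trans (mono-⊗ a (mono b)) (shift-mono a)
  where
  shift-mono : ∀ a → shift a (mono b) ≗ mono (a ℕ.+ b)
  shift-mono zero    n       = refl
  shift-mono (suc a) zero    = refl
  shift-mono (suc a) (suc n) = shift-mono a n

geom-unfold : ∀ i → geom i ≗ onePS ⊕ (mono (suc i) ⊗ geom i)
geom-unfold i n with ℕₚ.<-≤-connex n (suc i)
... | inj₁ n<1+i = begin
  (if does (n % suc i ≟ 0) then 1ℚ else 0ℚ)  ≡⟨ cong (λ r → if does (r ≟ 0) then 1ℚ else 0ℚ) (m<n⇒m%n≡m n<1+i) ⟩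
  (if does (n ≟ 0) then 1ℚ else 0ℚ)          ≡⟨ indicator-zero n ⟩
  onePS n                                     ≡⟨ sym (+-identityʳ (onePS n)) ⟩
  onePS n + 0ℚ                                ≡⟨ cong (onePS n +_) (sym (shift-< (suc i) (geom i) n<1+i)) ⟩
  onePS n + shift (suc i) (geom i) n          ≡⟨ cong (onePS n +_) (sym (mono-⊗ (suc i) (geom i) n)) ⟩
  onePS n + (mono (suc i) ⊗ geom i) n         ∎
  where
  open ≡-Reasoning
  indicator-zero : ∀ n → (if does (n ≟ 0) then 1ℚ else 0ℚ) ≡ onePS n
  indicator-zero zero    = refl
  indicator-zero (suc n) = refl
... | inj₂ 1+i≤n with ℕₚ.m≤n⇒∃[o]m+o≡n 1+i≤n
... | r , refl = begin
  geom i (suc i ℕ.+ r)                             ≡⟨ cong (λ s → if does (s ≟ 0) then 1ℚ else 0ℚ) period ⟩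
  geom i r                                         ≡⟨ sym (shift-+ (suc i) (geom i) r) ⟩
  shift (suc i) (geom i) (suc i ℕ.+ r)             ≡⟨ sym (mono-⊗ (suc i) (geom i) (suc i ℕ.+ r)) ⟩
  (mono (suc i) ⊗ geom i) (suc i ℕ.+ r)            ≡⟨ sym (+-identityˡ _) ⟩
  0ℚ + (mono (suc i) ⊗ geom i) (suc i ℕ.+ r)       ∎
  where
  open ≡-Reasoning
  period : (suc i ℕ.+ r) % suc i ≡ r % suc i
  period = trans (cong (_% suc i) (ℕₚ.+-comm (suc i) r)) ([m+n]%n≡m%n r (suc i))

Combination : Set → Set
Combination I = List (ℚ × I)

linComb : {I : Set} → (I → PS) → Combination I → PS
linComb F []            = zeroPS
linComb F ((c , i) ∷ L) = (c · F i) ⊕ linComb F L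

scale : {I : Set} → ℚ → Combination I → Combination I
scale c = map (λ (a , i) → c * a , i)

reindex : {I J : Set} → (I → J) → Combination I → Combination J
reindex h = map (λ (a , i) → a , h i)

_>>=_ : {I J : Set} → Combination I → (I → Combination J) → Combination J
[]            >>= K = []
((c , i) ∷ L) >>= K = scale c (K i) ++ (L >>= K)

pairs : {I J : Set} → Combination I → Combination J → Combination (I × J)
pairs R L = R >>= λ a → reindex (a ,_) L

linComb-cong : ∀ {I : Set} {F F′ : I → PS} L → (∀ i → F i ≗ F′ i) → linComb F L ≗ linComb F′ L
linComb-cong []            p = ≗-refl
linComb-cong ((c , i) ∷ L) p = ⊕-cong (·-cong c (p i)) (linComb-cong L p)

linComb-cong-at : ∀ {I : Set} {F F′ : I → PS} L n → (∀ i → F i n ≡ F′ i n) → linComb F L n ≡ linComb F′ L n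
linComb-cong-at []            n p = refl
linComb-cong-at ((c , i) ∷ L) n p = cong₂ (λ u v → c * u + v) (p i) (linComb-cong-at L n p)

linComb-zero : ∀ {I : Set} (L : Combination I) → linComb (λ _ → zeroPS) L ≗ zeroPS
linComb-zero []            = ≗-refl
linComb-zero ((c , i) ∷ L) = ≗-trans (⊕-cong (·-zeroʳ c) (linComb-zero L)) (⊕-identityˡ zeroPS)

linComb-⊕ : ∀ {I : Set} (F G : I → PS) L → linComb (λ i → F i ⊕ G i) L ≗ linComb F L ⊕ linComb G L
linComb-⊕ F G []            n = sym (+-identityˡ 0ℚ)
linComb-⊕ F G ((c , i) ∷ L) n =
  trans (cong (c * (F i n + G i n) +_) (linComb-⊕ F G L n))
    (solve 5 (λ c a b r s → c :* (a :+ b) :+ (r :+ s) := (c :* a :+ r) :+ (c :* b :+ s)) refl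
      c (F i n) (G i n) (linComb F L n) (linComb G L n))

linComb-++ : ∀ {I : Set} (F : I → PS) L₁ L₂ → linComb F (L₁ ++ L₂) ≗ linComb F L₁ ⊕ linComb F L₂
linComb-++ F []             L₂ = ≗-sym (⊕-identityˡ (linComb F L₂))
linComb-++ F ((c , i) ∷ L₁) L₂ =
  ≗-trans (⊕-congʳ (c · F i) (linComb-++ F L₁ L₂)) (≗-sym (⊕-assoc (c · F i) (linComb F L₁) (linComb F L₂)))

linComb-scale : ∀ {I : Set} (F : I → PS) c L → linComb F (scale c L) ≗ c · linComb F L
linComb-scale F c []            = ≗-sym (·-zeroʳ c)
linComb-scale F c ((a , i) ∷ L) =
  ≗-trans (⊕-cong (≗-sym (·-assoc c a (F i))) (linComb-scale F c L)) (≗-sym (·-distribˡ-⊕ c (a · F i) (linComb F L)))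

linComb-reindex : ∀ {I J : Set} (F : J → PS) (h : I → J) L → linComb F (reindex h L) ≗ linComb (F ∘ h) L
linComb-reindex F h []            = ≗-refl
linComb-reindex F h ((a , i) ∷ L) = ⊕-congʳ (a · F (h i)) (linComb-reindex F h L)

linComb->>= : ∀ {I J : Set} (F : J → PS) L (K : I → Combination J) →
              linComb F (L >>= K) ≗ linComb (λ i → linComb F (K i)) L
linComb->>= F []            K = ≗-refl
linComb->>= F ((c , i) ∷ L) K =
  ≗-trans (linComb-++ F (scale c (K i)) (L >>= K)) (⊕-cong (linComb-scale F c (K i)) (linComb->>= F L K))

⊗-linComb : ∀ {I : Set} h (F : I → PS) L → h ⊗ linComb F L ≗ linComb (λ i → h ⊗ F i) L
⊗-linComb h F []            = ⊗-zeroʳ h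
⊗-linComb h F ((a , i) ∷ L) =
  ≗-trans (⊗-distribˡ-⊕ h (a · F i) (linComb F L)) (⊕-cong (⊗-· a h (F i)) (⊗-linComb h F L))

linComb-⊗-linComb : ∀ {I J : Set} (F : I → PS) (G : J → PS) R L →
  linComb F R ⊗ linComb G L ≗ linComb (λ p → F (proj₁ p) ⊗ G (proj₂ p)) (pairs R L)
linComb-⊗-linComb {I} {J} F G R L = begin
  linComb F R ⊗ linComb G L
    ≈⟨ ⊗-comm (linComb F R) (linComb G L) ⟩
  linComb G L ⊗ linComb F R
    ≈⟨ ⊗-linComb (linComb G L) F R ⟩
  linComb (λ a → linComb G L ⊗ F a) R
    ≈⟨ linComb-cong R (λ a → ≗-trans (⊗-comm (linComb G L) (F a)) (⊗-linComb (F a) G L)) ⟩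
  linComb (λ a → linComb (λ b → F a ⊗ G b) L) R
    ≈⟨ linComb-cong R (λ a → ≗-sym (linComb-reindex FG (a ,_) L)) ⟩
  linComb (λ a → linComb FG (reindex (a ,_) L)) R
    ≈⟨ ≗-sym (linComb->>= FG R (λ a → reindex (a ,_) L)) ⟩
  linComb FG (pairs R L)
    ∎
  where
  open ≈-Reasoning
  FG : I × J → PS
  FG p = F (proj₁ p) ⊗ G (proj₂ p)

-- The coefficient of y^j in (1+y)^k is the number of occurrences of j, i.e. (k choose j).
binomial : ℕ → Combination ℕ
binomial zero    = (1ℚ , 0) ∷ []
binomial (suc k) = binomial k ++ reindex suc (binomial k)

ratio : ℕ → PS
ratio i = mono (suc i) ⊗ geom i

module _ (i : ℕ) where

  private
    x y : PS
    x = mono (suc i)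
    y = ratio i

    eval : ∀ {n} → Vec ℚ n → PS
    eval cs = evalAt cs (suc i) 0

  evalAt-suc : ∀ {n} (cs : Vec ℚ n) j → evalAt cs (suc i) (suc j) ≗ x ⊗ evalAt cs (suc i) j
  evalAt-suc []       j = ≗-sym (⊗-zeroʳ x)
  evalAt-suc (c ∷ cs) j = begin
    (c · mono (suc i ℕ.* suc j)) ⊕ evalAt cs (suc i) (suc (suc j))
      ≈⟨ ⊕-cong (·-cong c mono-step) (evalAt-suc cs (suc j)) ⟩
    (c · (x ⊗ mono (suc i ℕ.* j))) ⊕ (x ⊗ evalAt cs (suc i) (suc j))
      ≈⟨ ⊕-cong (≗-sym (⊗-· c x (mono (suc i ℕ.* j)))) ≗-refl ⟩
    (x ⊗ (c · mono (suc i ℕ.* j))) ⊕ (x ⊗ evalAt cs (suc i) (suc j))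
      ≈⟨ ≗-sym (⊗-distribˡ-⊕ x (c · mono (suc i ℕ.* j)) (evalAt cs (suc i) (suc j))) ⟩
    x ⊗ ((c · mono (suc i ℕ.* j)) ⊕ evalAt cs (suc i) (suc j))
      ∎
    where
    open ≈-Reasoning
    mono-step : mono (suc i ℕ.* suc j) ≗ x ⊗ mono (suc i ℕ.* j)
    mono-step n = trans (cong (λ d → mono d n) (ℕₚ.*-suc (suc i) j)) (sym (mono-+ (suc i) _ n))

  eval-cons : ∀ {n} c (cs : Vec ℚ n) → eval (c ∷ cs) ≗ (c · onePS) ⊕ (x ⊗ eval cs)
  eval-cons c cs = ⊕-cong (·-cong c mono-constant) (evalAt-suc cs 0)
    where
    mono-constant : mono (suc i ℕ.* 0) ≗ onePS
    mono-constant n = trans (cong (λ d → mono d n) (ℕₚ.*-zeroʳ (suc i))) (mono-zero n)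

  factor-const : ∀ c → factor (0 , c ∷ []) i ≗ c · onePS
  factor-const c = begin
    eval (c ∷ []) ⊗ onePS          ≈⟨ ⊗-identityʳ (eval (c ∷ [])) ⟩
    eval (c ∷ [])                  ≈⟨ eval-cons c [] ⟩
    (c · onePS) ⊕ (x ⊗ zeroPS)     ≈⟨ ⊕-congʳ (c · onePS) (⊗-zeroʳ x) ⟩
    (c · onePS) ⊕ zeroPS           ≈⟨ ⊕-identityʳ (c · onePS) ⟩
    c · onePS                      ∎
    where open ≈-Reasoning

  geomPow-suc : ∀ k → geomPow i (suc k) ≗ geomPow i k ⊕ (y ⊗ geomPow i k)
  geomPow-suc k = begin
    geom i ⊗ geomPow i k                              ≈⟨ ⊗-congˡ (geomPow i k) (geom-unfold i) ⟩
    (onePS ⊕ y) ⊗ geomPow i k                         ≈⟨ ⊗-distribʳ-⊕ onePS y (geomPow i k) ⟩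
    (onePS ⊗ geomPow i k) ⊕ (y ⊗ geomPow i k)         ≈⟨ ⊕-cong (⊗-identityˡ (geomPow i k)) ≗-refl ⟩
    geomPow i k ⊕ (y ⊗ geomPow i k)                   ∎
    where open ≈-Reasoning

  factor-cons : ∀ k c cs → factor (suc k , c ∷ cs) i ≗ (c · geomPow i (suc k)) ⊕ (y ⊗ factor (k , cs) i)
  factor-cons k c cs = begin
    eval (c ∷ cs) ⊗ geomPow i (suc k)
      ≈⟨ ⊗-congˡ (geomPow i (suc k)) (eval-cons c cs) ⟩
    ((c · onePS) ⊕ (x ⊗ eval cs)) ⊗ geomPow i (suc k)
      ≈⟨ ⊗-distribʳ-⊕ (c · onePS) (x ⊗ eval cs) (geomPow i (suc k)) ⟩
    ((c · onePS) ⊗ geomPow i (suc k)) ⊕ ((x ⊗ eval cs) ⊗ (geom i ⊗ geomPow i k))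
      ≈⟨ ⊕-cong (≗-trans (·-⊗ c onePS (geomPow i (suc k))) (·-cong c (⊗-identityˡ (geomPow i (suc k))))) (⊗-interchange x (eval cs) (geom i) (geomPow i k)) ⟩
    (c · geomPow i (suc k)) ⊕ (y ⊗ factor (k , cs) i)
      ∎
    where open ≈-Reasoning

  factor-cons-zero : ∀ k cs → factor (suc k , 0ℚ ∷ cs) i ≗ y ⊗ factor (k , cs) i
  factor-cons-zero k cs =
    ≗-trans (factor-cons k 0ℚ cs) (≗-trans (⊕-congˡ (y ⊗ factor (k , cs) i) (·-zeroˡ (geomPow i (suc k)))) (⊕-identityˡ _))

  szFactor : ℕ → PS
  szFactor j = factor (szEntry j) i

  szFactor-zero : szFactor 0 ≗ onePS
  szFactor-zero = ≗-trans (factor-const 1ℚ) (·-identityˡ onePS)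

  ⊗-linComb-szFactor : ∀ L → y ⊗ linComb szFactor L ≗ linComb (szFactor ∘ suc) L
  ⊗-linComb-szFactor L =
    ≗-trans (⊗-linComb y szFactor L) (linComb-cong L (λ j → ≗-sym (factor-cons-zero j (xPow j))))

  geomPow-expansion : ∀ k → geomPow i k ≗ linComb szFactor (binomial k)
  geomPow-expansion zero = ≗-sym (≗-trans (⊕-identityʳ _) (≗-trans (·-identityˡ _) szFactor-zero))
  geomPow-expansion (suc k) = begin
    geomPow i (suc k)
      ≈⟨ geomPow-suc k ⟩
    geomPow i k ⊕ (y ⊗ geomPow i k)
      ≈⟨ ⊕-cong (geomPow-expansion k) (⊗-congʳ y (geomPow-expansion k)) ⟩
    linComb szFactor B ⊕ (y ⊗ linComb szFactor B)
      ≈⟨ ⊕-congʳ (linComb szFactor B) (≗-trans (⊗-linComb-szFactor B) (≗-sym (linComb-reindex szFactor suc B))) ⟩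
    linComb szFactor B ⊕ linComb szFactor (reindex suc B)
      ≈⟨ ≗-sym (linComb-++ szFactor B (reindex suc B)) ⟩
    linComb szFactor (binomial (suc k))
      ∎
    where
    open ≈-Reasoning
    B : Combination ℕ
    B = binomial k

factorExpansion : (k : ℕ) → Vec ℚ (suc k) → Combination ℕ
factorExpansion zero    (c ∷ []) = (c , 0) ∷ []
factorExpansion (suc k) (c ∷ cs) = scale c (binomial (suc k)) ++ reindex suc (factorExpansion k cs)

factor-expansion : ∀ i k cs → factor (k , cs) i ≗ linComb (szFactor i) (factorExpansion k cs)
factor-expansion i zero (c ∷ []) =
  ≗-trans (factor-const i c) (≗-sym (≗-trans (⊕-identityʳ _) (·-cong c (szFactor-zero i))))
factor-expansion i (suc k) (c ∷ cs) = begin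
  factor (suc k , c ∷ cs) i
    ≈⟨ factor-cons i k c cs ⟩
  (c · geomPow i (suc k)) ⊕ (y ⊗ factor (k , cs) i)
    ≈⟨ ⊕-cong (·-cong c (geomPow-expansion i (suc k))) (⊗-congʳ y (factor-expansion i k cs)) ⟩
  (c · linComb F (binomial (suc k))) ⊕ (y ⊗ linComb F E)
    ≈⟨ ⊕-cong (≗-sym (linComb-scale F c (binomial (suc k)))) (≗-trans (⊗-linComb-szFactor i E) (≗-sym (linComb-reindex F suc E))) ⟩
  linComb F (scale c (binomial (suc k))) ⊕ linComb F (reindex suc E)
    ≈⟨ ≗-sym (linComb-++ F (scale c (binomial (suc k))) (reindex suc E)) ⟩
  linComb F (factorExpansion (suc k) (c ∷ cs))
    ∎
  where
  open ≈-Reasoning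
  F : ℕ → PS
  F = szFactor i
  E : Combination ℕ
  E = factorExpansion k cs
  y : PS
  y = ratio i

factor-expansion-admissible : ∀ i k cs → factor (suc k , 0ℚ ∷ cs) i ≗ linComb (szFactor i ∘ suc) (factorExpansion k cs)
factor-expansion-admissible i k cs =
  ≗-trans (factor-cons-zero i k cs)
    (≗-trans (⊗-congʳ (ratio i) (factor-expansion i k cs)) (⊗-linComb-szFactor i (factorExpansion k cs)))

sumPS-cong : ∀ {A B : ℕ → PS} N → (∀ t → A t ≗ B t) → sumPS A N ≗ sumPS B N
sumPS-cong zero    p = ≗-refl
sumPS-cong (suc N) p = ⊕-cong (sumPS-cong N p) (p N)

sumPS-zero : ∀ N → sumPS (λ _ → zeroPS) N ≗ zeroPS
sumPS-zero zero    = ≗-refl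
sumPS-zero (suc N) = ≗-trans (⊕-congˡ zeroPS (sumPS-zero N)) (⊕-identityˡ zeroPS)

sumPS-linComb : ∀ {I : Set} (H : ℕ → I → PS) L N →
                sumPS (λ t → linComb (H t) L) N ≗ linComb (λ a → sumPS (λ t → H t a) N) L
sumPS-linComb H L zero    = ≗-sym (linComb-zero L)
sumPS-linComb H L (suc N) =
  ≗-trans (⊕-congˡ (linComb (H N) L) (sumPS-linComb H L N))
    (≗-sym (linComb-⊕ (λ a → sumPS (λ t → H t a) N) (λ a → H N a) L))

bounded-cons-linComb : ∀ {I J : Set} (h : I → Entry) (hs : J → List Entry) e es R L →
  (∀ t → factor e t ≗ linComb (λ a → factor (h a) t) R) →
  (∀ M → bounded es M ≗ linComb (λ b → bounded (hs b) M) L) →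
  ∀ M → bounded (e ∷ es) M ≗ linComb (λ p → bounded (h (proj₁ p) ∷ hs (proj₂ p)) M) (pairs R L)
bounded-cons-linComb {I} {J} h hs e es R L factor≗ bounded≗ M = begin
  sumPS (λ t → factor e t ⊗ bounded es (suc t)) (M ∸ 1)
    ≈⟨ sumPS-cong (M ∸ 1) (λ t → ≗-trans (⊗-congˡ (bounded es (suc t)) (factor≗ t)) (⊗-congʳ (F t) (bounded≗ (suc t)))) ⟩
  sumPS (λ t → F t ⊗ linComb (λ b → bounded (hs b) (suc t)) L) (M ∸ 1)
    ≈⟨ sumPS-cong (M ∸ 1) (λ t → linComb-⊗-linComb (λ a → factor (h a) t) (λ b → bounded (hs b) (suc t)) R L) ⟩
  sumPS (λ t → linComb (H t) (pairs R L)) (M ∸ 1)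
    ≈⟨ sumPS-linComb H (pairs R L) (M ∸ 1) ⟩
  linComb (λ p → bounded (h (proj₁ p) ∷ hs (proj₂ p)) M) (pairs R L)
    ∎
  where
  open ≈-Reasoning
  F : ℕ → PS
  F t = linComb (λ a → factor (h a) t) R
  H : ℕ → I × J → PS
  H t p = factor (h (proj₁ p)) t ⊗ bounded (hs (proj₂ p)) (suc t)

expand : List Entry → Combination (List ℕ)
expand []              = (1ℚ , []) ∷ []
expand ((k , cs) ∷ es) = reindex (uncurry _∷_) (pairs (factorExpansion k cs) (expand es))

bounded-expand : ∀ es M → bounded es M ≗ linComb (λ ks → bounded (map szEntry ks) M) (expand es)
bounded-expand []              M = ≗-sym (≗-trans (⊕-identityʳ _) (·-identityˡ onePS))
bounded-expand ((k , cs) ∷ es) M =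
  ≗-trans (bounded-cons-linComb szEntry (map szEntry) (k , cs) es (factorExpansion k cs) (expand es)
             (λ t → factor-expansion t k cs) (bounded-expand es) M)
          (≗-sym (linComb-reindex (λ ks → bounded (map szEntry ks) M) (uncurry _∷_) (pairs (factorExpansion k cs) (expand es))))

foldr-linComb : ∀ {I : Set} (G : I → PS) L n → foldr (λ { (c , i) acc → c * G i n + acc }) 0ℚ L ≡ linComb G L n
foldr-linComb G []            n = refl
foldr-linComb G ((c , i) ∷ L) n = cong (c * G i n +_) (foldr-linComb G L n)

linComb⇒InSpan : ∀ {I : Set} {G : I → PS} {f} L → f ≗ linComb G L → InSpan G f
linComb⇒InSpan {G = G} L f≗ = L , λ n → trans (f≗ n) (sym (foldr-linComb G L n))

InSpan-generator : ∀ {I : Set} (G : I → PS) i → InSpan G (G i)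
InSpan-generator G i = linComb⇒InSpan ((1ℚ , i) ∷ []) (≗-sym (≗-trans (⊕-identityʳ _) (·-identityˡ (G i))))

InSpan-trans : ∀ {I J : Set} {G : I → PS} {H : J → PS} {f} → (∀ i → InSpan H (G i)) → InSpan G f → InSpan H f
InSpan-trans {I} {J} {G} {H} {f} G⊆H (L , f≡) = linComb⇒InSpan (L >>= K) (begin
  f                                  ≈⟨ (λ n → trans (f≡ n) (foldr-linComb G L n)) ⟩
  linComb G L                        ≈⟨ linComb-cong L (λ i n → trans (proj₂ (G⊆H i) n) (foldr-linComb H (K i) n)) ⟩
  linComb (λ i → linComb H (K i)) L  ≈⟨ ≗-sym (linComb->>= H L K) ⟩
  linComb H (L >>= K)                ∎)
  where
  open ≈-Reasoning
  K : I → Combination J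
  K i = proj₁ (G⊆H i)

toSZ : ℕ × List ℕ → Σ (List ℕ) SZAdmissible
toSZ (a , ks) = (suc a ∷ ks) , (a , refl)

szExpansion : Σ (List Entry) Admissible → Combination (Σ (List ℕ) SZAdmissible)
szExpansion ([] , _)                      = (1ℚ , ([] , tt)) ∷ []
szExpansion (((zero , _) ∷ _) , _)        = []
szExpansion (((suc k , _ ∷ cs) ∷ es) , _) = reindex toSZ (pairs (factorExpansion k cs) (expand es))

zetaq-szExpansion : ∀ z → ZGen z ≗ linComb SZGen (szExpansion z)
zetaq-szExpansion ([] , _) = ≗-sym (≗-trans (⊕-identityʳ _) (·-identityˡ onePS))
-- For k₁ = 0 admissibility forces Q₁ = 0, so every term of the sum vanishes.
zetaq-szExpansion (((zero , c ∷ []) ∷ es) , refl) n =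
  trans (sumPS-cong (suc n) (λ t → ≗-trans (⊗-congˡ (bounded es (suc t)) (factor-vanishes t)) (⊗-zeroˡ (bounded es (suc t)))) n)
        (sumPS-zero (suc n) n)
  where
  factor-vanishes : ∀ t → factor (0 , 0ℚ ∷ []) t ≗ zeroPS
  factor-vanishes t = ≗-trans (factor-const t 0ℚ) (·-zeroˡ onePS)
zetaq-szExpansion (((suc k , c ∷ cs) ∷ es) , refl) n = begin
  bounded ((suc k , 0ℚ ∷ cs) ∷ es) (suc (suc n)) n
    ≡⟨ bounded-cons-linComb (szEntry ∘ suc) (map szEntry) (suc k , 0ℚ ∷ cs) es (factorExpansion k cs) (expand es)
         (λ t → factor-expansion-admissible t k cs) (bounded-expand es) (suc (suc n)) n ⟩
  linComb (λ p → bounded (szEntry (suc (proj₁ p)) ∷ map szEntry (proj₂ p)) (suc (suc n))) P n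
    ≡⟨ linComb-cong-at P n (λ _ → refl) ⟩
  linComb (SZGen ∘ toSZ) P n
    ≡⟨ sym (linComb-reindex SZGen toSZ P n) ⟩
  linComb SZGen (reindex toSZ P) n
    ∎
  where
  open ≡-Reasoning
  P : Combination (ℕ × List ℕ)
  P = pairs (factorExpansion k cs) (expand es)

szAdmissible : ∀ ks → SZAdmissible ks → Admissible (map szEntry ks)
szAdmissible []           _          = tt
szAdmissible (suc k ∷ ks) (_ , refl) = refl

toZ : Σ (List ℕ) SZAdmissible → Σ (List Entry) Admissible
toZ (ks , a) = map szEntry ks , szAdmissible ks a

proposition2p12 : ∀ (f : PS) → (InSpan ZGen f → InSpan SZGen f) × (InSpan SZGen f → InSpan ZGen f)
proposition2p12 f =
  InSpan-trans (λ z → linComb⇒InSpan (szExpansion z) (zetaq-szExpansion z)) ,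
  InSpan-trans (λ s → InSpan-generator ZGen (toZ s))
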